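{- Let $\alpha\in\mathbb Z\setminus\{0,1\}$, put $\zeta=\alpha-(\alpha-1)^2=-\alpha^2+3\alpha-1$ and $\delta=(\alpha-1)(2\alpha-1)$, and let $(h_n)$ be the sequence with $h_0=0$, $h_1=1$, $h_2=-\alpha^3\delta\zeta^4$, $h_3=-\alpha^9\delta^3\zeta^{10}$, $h_4=\alpha^{16}\delta^6\zeta^{19}$, and for $m\ge2$: $h_{2m+1}=h_{m+2}h_m^3-h_{m-1}h_{m+1}^3$, for $m\ge 3$: $h_{2m}=h_m\big(h_{m+2}h_{m-1}^2-h_{m-2}h_{m+1}^2\big)/h_2$. (i) If $n\equiv 1,9,11,19\pmod{20}$, then $h_n$ is a square. (ii) If $n\equiv 4,16\pmod{20}$, then $h_n$ is a square if and only if $-\alpha^2+3\alpha-1$ is a square. (iii) If $n\equiv 5,15\pmod{20}$, then $h_n$ is a square if and only if $\alpha$ is a square.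
   Context: The sequence defined is the elliptic divisibility sequence attached to the point $(0,0)$ of order $10$ on the curve $y^2+(\zeta^2-\zeta\delta)xy-\alpha^2\delta\zeta^4y=x^3-\delta\alpha^2x^2$ (an integral model of the Tate normal form for torsion of order 10); its tenth term is zero. Convention: an integer $m$ is called a square if $m=\pm\beta^2$ for some nonzero integer $\beta$. -}

module Defs where

open import Data.Nat as ℕ using (ℕ; suc; _%_)
open import Data.Integer using (ℤ; +_; -_; _+_; _-_; _*_; _^_)
open import Data.Product using (∃; _×_)
open import Data.Sum using (_⊎_)
open import Relation.Binary.PropositionalEquality using (_≡_; _≢_)

ζ : ℤ → ℤ
ζ α = - (α * α) + (+ 3) * α - + 1

δ : ℤ → ℤ
δ α = (α - + 1) * ((+ 2) * α - + 1)

-- Paper's convention: m is a square iff m = ±β² for some nonzero integer β.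
IsSquare : ℤ → Set
IsSquare m = ∃ λ β → (β ≢ + 0) × ((m ≡ β * β) ⊎ (m ≡ - (β * β)))

-- The even-index recursion h_{2m} = h_m(...)/h_2 is stated in the
-- equivalent multiplied-out form h_{2m} * h_2 = h_m(...) (h_2 ≠ 0 for α ∉ {0,1}).
IsSeq : ℤ → (ℕ → ℤ) → Set
IsSeq α h =
  (h 0 ≡ + 0) ×
  (h 1 ≡ + 1) ×
  (h 2 ≡ - (α ^ 3 * δ α * ζ α ^ 4)) ×
  (h 3 ≡ - (α ^ 9 * δ α ^ 3 * ζ α ^ 10)) ×
  (h 4 ≡ α ^ 16 * δ α ^ 6 * ζ α ^ 19) ×
  (∀ m → 2 ℕ.≤ m →
     h (2 ℕ.* m ℕ.+ 1) ≡ h (m ℕ.+ 2) * h m ^ 3 - h (m ℕ.∸ 1) * h (m ℕ.+ 1) ^ 3) ×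
  (∀ m → 3 ℕ.≤ m →
     h (2 ℕ.* m) * h 2 ≡
       h m * (h (m ℕ.+ 2) * h (m ℕ.∸ 1) ^ 2 - h (m ℕ.∸ 2) * h (m ℕ.+ 1) ^ 2))

module Submission where

open import Defs
open import Data.Nat using (ℕ; _%_)
open import Data.Integer using (ℤ; +_)
open import Data.Product using (_×_)
open import Data.Sum using (_⊎_)
open import Function.Bundles using (_⇔_)
open import Relation.Binary.PropositionalEquality using (_≡_; _≢_)

open import Data.Bool using (Bool; true; false; _xor_)
open import Data.Empty using (⊥)
open import Data.List using (List; []; _∷_; _++_; replicate)
open import Data.Maybe using (Maybe; just; nothing)
open import Data.Nat as ℕ using (zero; suc; _⊓_; _∸_; z≤n; s≤s)
import Data.Nat.Properties as ℕP
import Data.Nat.Tactic.RingSolver as ℕRing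
open import Data.Nat.Induction using (<-rec)
open import Data.Nat.Base using (NonZero; ≢-nonZero)
open import Data.Nat.DivMod using (m≡m%n+[m/n]*n; m/n*n≡m)
open import Data.Nat.GCD using (gcd; gcd[m,n]∣m; gcd[m,n]∣n; gcd[m,n]≢0)
open import Data.Nat.Coprimality using (Coprime; coprime-/gcd; coprime-divisor)
open import Data.Nat.Divisibility using (divides; ∣-refl)
open import Data.Integer using (-_; _+_; _-_; _*_; _^_; ∣_∣)
import Data.Integer.Base as ℤ
import Data.Integer.Properties as ℤP
open import Data.Integer.Tactic.RingSolver using (solve-∀)
open import Data.Product using (∃; _,_; proj₁; proj₂)
open import Data.Sum using (inj₁; inj₂; [_,_]′)
open import Function.Base using (id)
open import Data.Unit using (⊤; tt)
open import Function.Bundles using (mk⇔)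
open import Relation.Binary.PropositionalEquality using (refl; sym; trans; cong; cong₂; subst; module ≡-Reasoning)
open ≡-Reasoning

-- The sequence is pinned down by h₀,…,h₄ and the two
-- recurrences (h₂ ≠ 0 lets us cancel in the even one), so it suffices to
-- exhibit one explicit solution W.  Every nonzero Wₙ is a signed monomial
-- in the four integers α, α-1, 2α-1, ζ; its exponent vector is given by a
-- table for n < 10 together with the quasi-periodicity law
--     W (10 + n) = c · uⁿ · W n,    c = P⁵, u = -P, P = α²¹(α-1)⁹(2α-1)⁸ζ²⁵,
-- (and W n = 0 for 10 ∣ n).  A general lemma about quasi-periodic
-- sequences shows that the recurrences propagate from m to m + 10, so only
-- twenty base instances have to be verified; after cancelling the common
-- monomial factor each reduces to one of four small polynomial identities
-- in α.  Iterating the law twice gives W (20 + n) = (c²uⁿ)² · W n, so the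
-- square class of hₙ depends only on n mod 20, and reading off the parity
-- of the exponents of W r for the relevant residues r proves (i)–(iii).

OddRel : (ℕ → ℤ) → ℕ → ℕ → ℕ → ℕ → ℕ → Set
OddRel w i j l m n = w i ≡ w j * w l ^ 3 - w m * w n ^ 3

EvenRel : (ℕ → ℤ) → ℕ → ℕ → ℕ → ℕ → ℕ → ℕ → Set
EvenRel w i m j l n r = w i * w 2 ≡ w m * (w j * w l ^ 2 - w n * w r ^ 2)

OddLaw : (ℕ → ℤ) → ℕ → Set
OddLaw w m = OddRel w (2 ℕ.* m ℕ.+ 1) (m ℕ.+ 2) m (m ℕ.∸ 1) (m ℕ.+ 1)

EvenLaw : (ℕ → ℤ) → ℕ → Set
EvenLaw w m = EvenRel w (2 ℕ.* m) m (m ℕ.+ 2) (m ℕ.∸ 1) (m ℕ.∸ 2) (m ℕ.+ 1)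

reindex-odd : ∀ w {i i′ j j′} l {m m′ n n′} → i ≡ i′ → j ≡ j′ → m ≡ m′ → n ≡ n′ →
              OddRel w i j l m n → OddRel w i′ j′ l m′ n′
reindex-odd w l refl refl refl refl r = r

reindex-even : ∀ w {i i′} m {j j′ l l′ n n′ r r′} →
               i ≡ i′ → j ≡ j′ → l ≡ l′ → n ≡ n′ → r ≡ r′ →
               EvenRel w i m j l n r → EvenRel w i′ m j′ l′ n′ r′
reindex-even w m refl refl refl refl refl e = e

odd-index : ∀ N k → 2 ℕ.* (N ℕ.+ suc k) ℕ.+ 1 ≡ N ℕ.+ (N ℕ.+ (3 ℕ.+ (k ℕ.+ k)))
odd-index = ℕRing.solve-∀

even-index : ∀ N k → 2 ℕ.* (N ℕ.+ (2 ℕ.+ k)) ≡ N ℕ.+ (N ℕ.+ (4 ℕ.+ (k ℕ.+ k)))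
even-index = ℕRing.solve-∀

plus-index : ∀ N m j → N ℕ.+ m ℕ.+ j ≡ N ℕ.+ (j ℕ.+ m)
plus-index = ℕRing.solve-∀

minus-index : ∀ N k j → N ℕ.+ (j ℕ.+ k) ℕ.∸ j ≡ N ℕ.+ k
minus-index N k j = trans (cong (ℕ._∸ j) (swap N k j)) (ℕP.m+n∸m≡n j (N ℕ.+ k))
  where
  swap : ∀ N k j → N ℕ.+ (j ℕ.+ k) ≡ j ℕ.+ (N ℕ.+ k)
  swap = ℕRing.solve-∀

module QuasiPeriodic (N : ℕ) (c u : ℤ) (c²≡uᴺ : c * c ≡ u ^ N)
                     (w : ℕ → ℤ) (shift : ∀ n → w (N ℕ.+ n) ≡ c * u ^ n * w n) where

  twice : ∀ n → w (N ℕ.+ (N ℕ.+ n)) ≡ (c * c * u ^ n) * (c * c * u ^ n) * w n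
  twice n = begin
    w (N ℕ.+ (N ℕ.+ n))                        ≡⟨ shift (N ℕ.+ n) ⟩
    c * u ^ (N ℕ.+ n) * w (N ℕ.+ n)            ≡⟨ cong₂ (λ x y → c * x * y) (ℤP.^-distribˡ-+-* u N n) (shift n) ⟩
    c * (u ^ N * u ^ n) * (c * u ^ n * w n)    ≡⟨ cong (λ x → c * (x * u ^ n) * (c * u ^ n * w n)) c²≡uᴺ ⟨
    c * (c * c * u ^ n) * (c * u ^ n * w n)    ≡⟨ regroup c (u ^ n) (w n) ⟩
    (c * c * u ^ n) * (c * c * u ^ n) * w n    ∎
    where
    regroup : ∀ x v y → x * (x * x * v) * (x * v * y) ≡ (x * x * v) * (x * x * v) * y
    regroup = solve-∀

  twice-split : ∀ j k → w (N ℕ.+ (N ℕ.+ (j ℕ.+ (k ℕ.+ k)))) ≡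
    (c * c * (u ^ j * (u ^ k * u ^ k))) * (c * c * (u ^ j * (u ^ k * u ^ k))) * w (j ℕ.+ (k ℕ.+ k))
  twice-split j k = trans (twice (j ℕ.+ (k ℕ.+ k)))
    (cong (λ v → (c * c * v) * (c * c * v) * w (j ℕ.+ (k ℕ.+ k)))
          (trans (ℤP.^-distribˡ-+-* u j (k ℕ.+ k)) (cong (u ^ j *_) (ℤP.^-distribˡ-+-* u k k))))

  -- The odd recurrence at m = 1 + k (indices normalised) implies it at N + m:
  -- both sides pick up the same factor c⁴ u⁶ u^{4k}.
  odd-step : ∀ k → OddRel w (3 ℕ.+ (k ℕ.+ k)) (3 ℕ.+ k) (1 ℕ.+ k) k (2 ℕ.+ k) →
             OddRel w (N ℕ.+ (N ℕ.+ (3 ℕ.+ (k ℕ.+ k)))) (N ℕ.+ (3 ℕ.+ k)) (N ℕ.+ (1 ℕ.+ k))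
                      (N ℕ.+ k) (N ℕ.+ (2 ℕ.+ k))
  odd-step k law = begin
    w (N ℕ.+ (N ℕ.+ (3 ℕ.+ (k ℕ.+ k))))       ≡⟨ twice-split 3 k ⟩
    s * s * w (3 ℕ.+ (k ℕ.+ k))               ≡⟨ cong (s * s *_) law ⟩
    s * s * (w (3 ℕ.+ k) * w (1 ℕ.+ k) ^ 3 - w k * w (2 ℕ.+ k) ^ 3)
      ≡⟨ spread c u (u ^ k) (w (3 ℕ.+ k)) (w (1 ℕ.+ k)) (w k) (w (2 ℕ.+ k)) ⟩
    (c * u ^ (3 ℕ.+ k) * w (3 ℕ.+ k)) * (c * u ^ (1 ℕ.+ k) * w (1 ℕ.+ k)) ^ 3
      - (c * u ^ k * w k) * (c * u ^ (2 ℕ.+ k) * w (2 ℕ.+ k)) ^ 3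
      ≡⟨ cong₂ _-_ (cong₂ (λ x y → x * y ^ 3) (shift (3 ℕ.+ k)) (shift (1 ℕ.+ k)))
                   (cong₂ (λ x y → x * y ^ 3) (shift k) (shift (2 ℕ.+ k))) ⟨
    w (N ℕ.+ (3 ℕ.+ k)) * w (N ℕ.+ (1 ℕ.+ k)) ^ 3 - w (N ℕ.+ k) * w (N ℕ.+ (2 ℕ.+ k)) ^ 3 ∎
    where
    s : ℤ
    s = c * c * (u ^ 3 * (u ^ k * u ^ k))
    -- powers are written out because the ring solver does not read _^_ on ℤ
    spread : ∀ x y a p q r t →
      let S = x * x * (y * (y * (y * + 1)) * (a * a))
          Q = x * (y * a) * q
          T = x * (y * (y * a)) * t in
      S * S * (p * (q * (q * (q * + 1))) - r * (t * (t * (t * + 1))))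
        ≡ (x * (y * (y * (y * a))) * p) * (Q * (Q * (Q * + 1))) - (x * a * r) * (T * (T * (T * + 1)))
    spread = solve-∀

  odd-transfer : ∀ k → OddLaw w (suc k) → OddLaw w (N ℕ.+ suc k)
  odd-transfer k law =
    reindex-odd w (N ℕ.+ suc k) (sym (odd-index N k)) (sym (plus-index N (suc k) 2))
      (sym (minus-index N k 1)) (sym (plus-index N (suc k) 1))
      (odd-step k (reindex-odd w (suc k) (odd-index 0 k) (plus-index 0 (suc k) 2) refl
        (plus-index 0 (suc k) 1) law))

  -- Likewise for the even recurrence at m = 2 + k (common factor c⁴ u⁸ u^{4k}).
  even-step : ∀ k → EvenRel w (4 ℕ.+ (k ℕ.+ k)) (2 ℕ.+ k) (4 ℕ.+ k) (1 ℕ.+ k) k (3 ℕ.+ k) →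
              EvenRel w (N ℕ.+ (N ℕ.+ (4 ℕ.+ (k ℕ.+ k)))) (N ℕ.+ (2 ℕ.+ k)) (N ℕ.+ (4 ℕ.+ k))
                        (N ℕ.+ (1 ℕ.+ k)) (N ℕ.+ k) (N ℕ.+ (3 ℕ.+ k))
  even-step k law = begin
    w (N ℕ.+ (N ℕ.+ (4 ℕ.+ (k ℕ.+ k)))) * w 2   ≡⟨ cong (_* w 2) (twice-split 4 k) ⟩
    s * s * w (4 ℕ.+ (k ℕ.+ k)) * w 2           ≡⟨ ℤP.*-assoc (s * s) _ _ ⟩
    s * s * (w (4 ℕ.+ (k ℕ.+ k)) * w 2)         ≡⟨ cong (s * s *_) law ⟩
    s * s * (w (2 ℕ.+ k) * (w (4 ℕ.+ k) * w (1 ℕ.+ k) ^ 2 - w k * w (3 ℕ.+ k) ^ 2))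
      ≡⟨ spread c u (u ^ k) (w (2 ℕ.+ k)) (w (4 ℕ.+ k)) (w (1 ℕ.+ k)) (w k) (w (3 ℕ.+ k)) ⟩
    (c * u ^ (2 ℕ.+ k) * w (2 ℕ.+ k))
      * ((c * u ^ (4 ℕ.+ k) * w (4 ℕ.+ k)) * (c * u ^ (1 ℕ.+ k) * w (1 ℕ.+ k)) ^ 2
         - (c * u ^ k * w k) * (c * u ^ (3 ℕ.+ k) * w (3 ℕ.+ k)) ^ 2)
      ≡⟨ cong₂ _*_ (shift (2 ℕ.+ k))
           (cong₂ _-_ (cong₂ (λ x y → x * y ^ 2) (shift (4 ℕ.+ k)) (shift (1 ℕ.+ k)))
                      (cong₂ (λ x y → x * y ^ 2) (shift k) (shift (3 ℕ.+ k)))) ⟨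
    w (N ℕ.+ (2 ℕ.+ k))
      * (w (N ℕ.+ (4 ℕ.+ k)) * w (N ℕ.+ (1 ℕ.+ k)) ^ 2 - w (N ℕ.+ k) * w (N ℕ.+ (3 ℕ.+ k)) ^ 2) ∎
    where
    s : ℤ
    s = c * c * (u ^ 4 * (u ^ k * u ^ k))
    -- powers are written out because the ring solver does not read _^_ on ℤ
    spread : ∀ x y a m p q r t →
      let S = x * x * (y * (y * (y * (y * + 1))) * (a * a))
          Q = x * (y * a) * q
          T = x * (y * (y * (y * a))) * t in
      S * S * (m * (p * (q * (q * + 1)) - r * (t * (t * + 1))))
        ≡ (x * (y * (y * a)) * m)
            * ((x * (y * (y * (y * (y * a)))) * p) * (Q * (Q * + 1)) - (x * a * r) * (T * (T * + 1)))
    spread = solve-∀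

  even-transfer : ∀ k → EvenLaw w (2 ℕ.+ k) → EvenLaw w (N ℕ.+ (2 ℕ.+ k))
  even-transfer k law =
    reindex-even w (N ℕ.+ (2 ℕ.+ k)) (sym (even-index N k)) (sym (plus-index N (2 ℕ.+ k) 2))
      (sym (minus-index N (1 ℕ.+ k) 1)) (sym (minus-index N k 2)) (sym (plus-index N (2 ℕ.+ k) 1))
      (even-step k (reindex-even w (2 ℕ.+ k) (even-index 0 k) (plus-index 0 (2 ℕ.+ k) 2) refl refl
        (plus-index 0 (2 ℕ.+ k) 1) law))

-- In ℕ, b² z = d² with b ≠ 0 forces z to be a perfect square: dividing b
-- and d by their gcd g makes them coprime, and then b/g ∣ (d/g)² gives b = g.
square-quotient : ∀ b z d → b ≢ 0 → b ℕ.* b ℕ.* z ≡ d ℕ.* d → ∃ λ e → z ≡ e ℕ.* e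
square-quotient b z d b≢0 b²z≡d² = d′ , z≡d′²
  where
  g : ℕ
  g = gcd b d
  instance
    g≢0 : NonZero g
    g≢0 = ≢-nonZero (gcd[m,n]≢0 b d (inj₁ b≢0))
    g²≢0 : NonZero (g ℕ.* g)
    g²≢0 = ℕP.m*n≢0 g g
  b′ d′ : ℕ
  b′ = b ℕ./ g
  d′ = d ℕ./ g
  coprime : Coprime b′ d′
  coprime = coprime-/gcd b d
  reduced : b′ ℕ.* b′ ℕ.* z ≡ d′ ℕ.* d′
  reduced = ℕP.*-cancelʳ-≡ _ _ (g ℕ.* g) (begin
    b′ ℕ.* b′ ℕ.* z ℕ.* (g ℕ.* g)          ≡⟨ pull-out b′ g z ⟩
    b′ ℕ.* g ℕ.* (b′ ℕ.* g) ℕ.* z          ≡⟨ cong (λ x → x ℕ.* x ℕ.* z) (m/n*n≡m (gcd[m,n]∣m b d)) ⟩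
    b ℕ.* b ℕ.* z                          ≡⟨ b²z≡d² ⟩
    d ℕ.* d                                ≡⟨ cong (λ x → x ℕ.* x) (m/n*n≡m (gcd[m,n]∣n b d)) ⟨
    d′ ℕ.* g ℕ.* (d′ ℕ.* g)                ≡⟨ square-* d′ g ⟨
    d′ ℕ.* d′ ℕ.* (g ℕ.* g)                ∎)
    where
    pull-out : ∀ x y t → x ℕ.* x ℕ.* t ℕ.* (y ℕ.* y) ≡ x ℕ.* y ℕ.* (x ℕ.* y) ℕ.* t
    pull-out = ℕRing.solve-∀
    square-* : ∀ x y → x ℕ.* x ℕ.* (y ℕ.* y) ≡ x ℕ.* y ℕ.* (x ℕ.* y)
    square-* = ℕRing.solve-∀
  b′≡1 : b′ ≡ 1
  b′≡1 = coprime (∣-refl , coprime-divisor coprime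
    (divides (b′ ℕ.* z) (trans (sym reduced) (rotate b′ z))))
    where
    rotate : ∀ x t → x ℕ.* x ℕ.* t ≡ x ℕ.* t ℕ.* x
    rotate = ℕRing.solve-∀
  z≡d′² : z ≡ d′ ℕ.* d′
  z≡d′² = trans (sym (ℕP.*-identityˡ z)) (trans (cong (λ x → x ℕ.* x ℕ.* z) (sym b′≡1)) reduced)

infix 4 _≡±_
_≡±_ : ℤ → ℤ → Set
x ≡± v = x ≡ v ⊎ x ≡ - v

±-scale : ∀ {x v} k → x ≡± v → k * x ≡± k * v
±-scale k (inj₁ x≡v)  = inj₁ (cong (k *_) x≡v)
±-scale k (inj₂ x≡-v) = inj₂ (trans (cong (k *_) x≡-v) (sym (ℤP.neg-distribʳ-* k _)))

±-trans : ∀ {x y z} → x ≡± y → y ≡± z → x ≡± z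
±-trans (inj₁ refl) y≡±z       = y≡±z
±-trans (inj₂ refl) (inj₁ refl) = inj₂ refl
±-trans (inj₂ refl) (inj₂ refl) = inj₁ (ℤP.neg-involutive _)

±-abs : ∀ {x v} → x ≡± v → ∣ x ∣ ≡ ∣ v ∣
±-abs (inj₁ refl) = refl
±-abs {v = v} (inj₂ refl) = ℤP.∣-i∣≡∣i∣ v

nonzero-* : ∀ {x y : ℤ} → x ≢ + 0 → y ≢ + 0 → x * y ≢ + 0
nonzero-* {x} x≢0 y≢0 xy≡0 with ℤP.i*j≡0⇒i≡0∨j≡0 x xy≡0
... | inj₁ x≡0 = x≢0 x≡0
... | inj₂ y≡0 = y≢0 y≡0

infix 4 _∼_
_∼_ : ℤ → ℤ → Set
x ∼ y = ∃ λ b → b ≢ + 0 × x ≡± b * b * y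

∼-trans : ∀ {x y z} → x ∼ y → y ∼ z → x ∼ z
∼-trans {z = z} (b , b≢0 , x≡±) (b′ , b′≢0 , y≡±) =
  b * b′ , nonzero-* b≢0 b′≢0 ,
  ±-trans x≡± (subst (λ v → b * b * _ ≡± v) (regroup b b′ z) (±-scale (b * b) y≡±))
  where
  regroup : ∀ b b′ z → b * b * (b′ * b′ * z) ≡ b * b′ * (b * b′) * z
  regroup = solve-∀

∼-preserves-square : ∀ {x y} → x ∼ y → IsSquare y → IsSquare x
∼-preserves-square (b , b≢0 , x≡±) (β , β≢0 , y≡±) =
  b * β , nonzero-* b≢0 β≢0 ,
  ±-trans x≡± (subst (λ v → b * b * _ ≡± v) (regroup b β) (±-scale (b * b) y≡±))
  where
  regroup : ∀ b β → b * b * (β * β) ≡ b * β * (b * β)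
  regroup = solve-∀

-- The converse direction is where arithmetic enters: from ±b²y = ±d² one
-- gets |b|²|y| = |d|², so |y| is a perfect square by square-quotient.
∼-reflects-square : ∀ {x y} → x ∼ y → IsSquare x → IsSquare y
∼-reflects-square {x} {y} (b , b≢0 , x≡±) (d , d≢0 , x≡±d²) = + e , e≢0 , y≡±e²
  where
  abs-equation : ∣ b ∣ ℕ.* ∣ b ∣ ℕ.* ∣ y ∣ ≡ ∣ d ∣ ℕ.* ∣ d ∣
  abs-equation = begin
    ∣ b ∣ ℕ.* ∣ b ∣ ℕ.* ∣ y ∣  ≡⟨ cong (ℕ._* ∣ y ∣) (ℤP.abs-* b b) ⟨
    ∣ b * b ∣ ℕ.* ∣ y ∣        ≡⟨ ℤP.abs-* (b * b) y ⟨
    ∣ b * b * y ∣              ≡⟨ ±-abs x≡± ⟨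
    ∣ x ∣                      ≡⟨ ±-abs x≡±d² ⟩
    ∣ d * d ∣                  ≡⟨ ℤP.abs-* d d ⟩
    ∣ d ∣ ℕ.* ∣ d ∣            ∎
  root : ∃ λ e → ∣ y ∣ ≡ e ℕ.* e
  root = square-quotient (∣ b ∣) (∣ y ∣) (∣ d ∣) (λ eq → b≢0 (ℤP.∣i∣≡0⇒i≡0 eq)) abs-equation
  e : ℕ
  e = proj₁ root
  ∣y∣≡e² : ∣ y ∣ ≡ e ℕ.* e
  ∣y∣≡e² = proj₂ root
  e≢0 : + e ≢ + 0
  e≢0 +e≡0 = d≢0 (ℤP.∣i∣≡0⇒i≡0 ([ id , id ]′ (ℕP.m*n≡0⇒m≡0∨n≡0 (∣ d ∣) (begin
    ∣ d ∣ ℕ.* ∣ d ∣            ≡⟨ abs-equation ⟨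
    ∣ b ∣ ℕ.* ∣ b ∣ ℕ.* ∣ y ∣  ≡⟨ cong (∣ b ∣ ℕ.* ∣ b ∣ ℕ.*_) (trans ∣y∣≡e² (cong (λ t → t ℕ.* t) (ℤP.+-injective +e≡0))) ⟩
    ∣ b ∣ ℕ.* ∣ b ∣ ℕ.* 0      ≡⟨ ℕP.*-zeroʳ (∣ b ∣ ℕ.* ∣ b ∣) ⟩
    0                          ∎))))
  +∣y∣≡e² : + ∣ y ∣ ≡ + e * + e
  +∣y∣≡e² = trans (cong +_ ∣y∣≡e²) (ℤP.pos-* e e)
  y≡±e² : y ≡± + e * + e
  y≡±e² with ℤP.+∣i∣≡i⊎+∣i∣≡-i y
  ... | inj₁ +∣y∣≡y  = inj₁ (trans (sym +∣y∣≡y) +∣y∣≡e²)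
  ... | inj₂ +∣y∣≡-y = inj₂ (trans (sym (ℤP.neg-involutive y)) (cong -_ (trans (sym +∣y∣≡-y) +∣y∣≡e²)))

∼-square-iff : ∀ {x y} → x ∼ y → IsSquare x ⇔ IsSquare y
∼-square-iff x∼y = mk⇔ (∼-reflects-square x∼y) (∼-preserves-square x∼y)

∼1⇒square : ∀ {x} → x ∼ + 1 → IsSquare x
∼1⇒square x∼1 = ∼-preserves-square x∼1 (+ 1 , (λ ()) , inj₁ refl)

-- Exponent vectors of signed monomials  ± αᵃ (α-1)ᵇ (2α-1)ᶜ ζᶻ.
record Exps : Set where
  constructor ⟨_∣_,_,_,_⟩
  field
    negative       : Bool
    ofα ofβ ofγ ofζ : ℕ

𝟙 : Exps
𝟙 = ⟨ false ∣ 0 , 0 , 0 , 0 ⟩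

_⊕_ : Exps → Exps → Exps
⟨ s ∣ a , b , c , z ⟩ ⊕ ⟨ s′ ∣ a′ , b′ , c′ , z′ ⟩ =
  ⟨ s xor s′ ∣ a ℕ.+ a′ , b ℕ.+ b′ , c ℕ.+ c′ , z ℕ.+ z′ ⟩

_·_ : ℕ → Exps → Exps
zero  · e = 𝟙
suc n · e = e ⊕ (n · e)

-- quotient of monomials (exact when the divisor's exponents are smaller)
_÷_ : Exps → Exps → Exps
⟨ s ∣ a , b , c , z ⟩ ÷ ⟨ s′ ∣ a′ , b′ , c′ , z′ ⟩ =
  ⟨ s xor s′ ∣ a ∸ a′ , b ∸ b′ , c ∸ c′ , z ∸ z′ ⟩

_⊓ᵉ_ : Exps → Exps → Exps
⟨ s ∣ a , b , c , z ⟩ ⊓ᵉ ⟨ _ ∣ a′ , b′ , c′ , z′ ⟩ = ⟨ s ∣ a ⊓ a′ , b ⊓ b′ , c ⊓ c′ , z ⊓ z′ ⟩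

_≼_ : Exps → Exps → Set
⟨ _ ∣ a , b , c , z ⟩ ≼ ⟨ _ ∣ a′ , b′ , c′ , z′ ⟩ = a ℕ.≤ a′ × b ℕ.≤ b′ × c ℕ.≤ c′ × z ℕ.≤ z′

≼-refl : ∀ e → e ≼ e
≼-refl ⟨ _ ∣ _ , _ , _ , _ ⟩ = ℕP.≤-refl , ℕP.≤-refl , ℕP.≤-refl , ℕP.≤-refl

≼-trans : ∀ g e e′ → g ≼ e → e ≼ e′ → g ≼ e′
≼-trans ⟨ _ ∣ _ , _ , _ , _ ⟩ ⟨ _ ∣ _ , _ , _ , _ ⟩ ⟨ _ ∣ _ , _ , _ , _ ⟩ (p , q , r , s) (p′ , q′ , r′ , s′) =
  ℕP.≤-trans p p′ , ℕP.≤-trans q q′ , ℕP.≤-trans r r′ , ℕP.≤-trans s s′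

⊓ᵉ-≼ˡ : ∀ e e′ → (e ⊓ᵉ e′) ≼ e
⊓ᵉ-≼ˡ ⟨ _ ∣ a , b , c , z ⟩ ⟨ _ ∣ a′ , b′ , c′ , z′ ⟩ =
  ℕP.m⊓n≤m a a′ , ℕP.m⊓n≤m b b′ , ℕP.m⊓n≤m c c′ , ℕP.m⊓n≤m z z′

⊓ᵉ-≼ʳ : ∀ e e′ → (e ⊓ᵉ e′) ≼ e′
⊓ᵉ-≼ʳ ⟨ _ ∣ a , b , c , z ⟩ ⟨ _ ∣ a′ , b′ , c′ , z′ ⟩ =
  ℕP.m⊓n≤n a a′ , ℕP.m⊓n≤n b b′ , ℕP.m⊓n≤n c c′ , ℕP.m⊓n≤n z z′

xor-restore : ∀ s s′ → s′ xor (s xor s′) ≡ s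
xor-restore false false = refl
xor-restore false true  = refl
xor-restore true  false = refl
xor-restore true  true  = refl

split : ∀ g e → g ≼ e → g ⊕ (e ÷ g) ≡ e
split ⟨ s′ ∣ a′ , b′ , c′ , z′ ⟩ ⟨ s ∣ a , b , c , z ⟩ (p , q , r , t)
  rewrite xor-restore s s′ | ℕP.m+[n∸m]≡n p | ℕP.m+[n∸m]≡n q | ℕP.m+[n∸m]≡n r | ℕP.m+[n∸m]≡n t = refl

-- Terms of the sequence: a signed monomial, or nothing for a vanishing term.
Term : Set
Term = Maybe Exps

_⊗_ : Term → Term → Term
just e ⊗ just e′ = just (e ⊕ e′)
_      ⊗ _       = nothing

power : ℕ → Term → Term
power zero    t = just 𝟙
power (suc n) t = t ⊗ power n t

_⊘_ : Term → Term → Term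
just e ⊘ just g = just (e ÷ g)
t      ⊘ _      = t

_∣ᵗ_ : Term → Term → Set
_        ∣ᵗ nothing = ⊤
nothing  ∣ᵗ just _  = ⊥
just g   ∣ᵗ just e  = g ≼ e

gcdᵗ : Term → Term → Term
gcdᵗ nothing  t         = t
gcdᵗ (just e) nothing   = just e
gcdᵗ (just e) (just e′) = just (e ⊓ᵉ e′)

∣ᵗ-trans : ∀ g s t → g ∣ᵗ s → s ∣ᵗ t → g ∣ᵗ t
∣ᵗ-trans _        _        nothing  _   _   = tt
∣ᵗ-trans (just g) (just s) (just t) g∣s s∣t = ≼-trans g s t g∣s s∣t

gcd-∣ˡ : ∀ s t → gcdᵗ s t ∣ᵗ s
gcd-∣ˡ nothing  _         = tt
gcd-∣ˡ (just e) nothing   = ≼-refl e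
gcd-∣ˡ (just e) (just e′) = ⊓ᵉ-≼ˡ e e′

gcd-∣ʳ : ∀ s t → gcdᵗ s t ∣ᵗ t
gcd-∣ʳ nothing  nothing   = tt
gcd-∣ʳ nothing  (just e)  = ≼-refl e
gcd-∣ʳ (just e) nothing   = tt
gcd-∣ʳ (just e) (just e′) = ⊓ᵉ-≼ʳ e e′

-- Product of a list, without a trailing factor 1, so that small monomials
-- evaluate to the expressions one would write by hand.
prod : List ℤ → ℤ
prod []           = + 1
prod (x ∷ [])     = x
prod (x ∷ y ∷ xs) = x * prod (y ∷ xs)

prod-∷ : ∀ x xs → prod (x ∷ xs) ≡ x * prod xs
prod-∷ x []      = sym (ℤP.*-identityʳ x)
prod-∷ x (_ ∷ _) = refl

prod-++ : ∀ xs ys → prod (xs ++ ys) ≡ prod xs * prod ys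
prod-++ []       ys = sym (ℤP.*-identityˡ (prod ys))
prod-++ (x ∷ xs) ys = begin
  prod (x ∷ xs ++ ys)       ≡⟨ prod-∷ x (xs ++ ys) ⟩
  x * prod (xs ++ ys)       ≡⟨ cong (x *_) (prod-++ xs ys) ⟩
  x * (prod xs * prod ys)   ≡⟨ ℤP.*-assoc x (prod xs) (prod ys) ⟨
  x * prod xs * prod ys     ≡⟨ cong (_* prod ys) (prod-∷ x xs) ⟨
  prod (x ∷ xs) * prod ys   ∎

prod-replicate : ∀ n x → prod (replicate n x) ≡ x ^ n
prod-replicate zero    x = refl
prod-replicate (suc n) x = trans (prod-∷ x (replicate n x)) (cong (x *_) (prod-replicate n x))

distrib-sub : ∀ (x y z : ℤ) → x * (y - z) ≡ x * y - x * z
distrib-sub = solve-∀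

signed : Bool → ℤ → ℤ
signed false x = x
signed true  x = - x

signed-* : ∀ s s′ x y → signed s x * signed s′ y ≡ signed (s xor s′) (x * y)
signed-* false false x y = refl
signed-* false true  x y = sym (ℤP.neg-distribʳ-* x y)
signed-* true  false x y = sym (ℤP.neg-distribˡ-* x y)
signed-* true  true  x y = neg*neg x y
  where
  neg*neg : ∀ x y → - x * - y ≡ x * y
  neg*neg = solve-∀

pow≢0 : ∀ {x : ℤ} n → x ≢ + 0 → x ^ n ≢ + 0
pow≢0 {x} n x≢0 xⁿ≡0 = x≢0 (ℤP.i^n≡0⇒i≡0 x n xⁿ≡0)

2α-1≢0 : ∀ α → + 2 * α - + 1 ≢ + 0
2α-1≢0 α 2α-1≡0 = ℕP.even≢odd ∣ α ∣ 0 (begin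
  2 ℕ.* ∣ α ∣     ≡⟨ ℤP.abs-* (+ 2) α ⟨
  ∣ + 2 * α ∣     ≡⟨ cong ∣_∣ (ℤP.i-j≡0⇒i≡j (+ 2 * α) (+ 1) 2α-1≡0) ⟩
  1               ∎)

ζ≢0 : ∀ α → α ≢ + 1 → ζ α ≢ + 0
ζ≢0 α α≢1 ζ≡0 = unit-case α α≢1 ζ≡0 (ℕP.m*n≡1⇒m≡1 ∣ α ∣ ∣ + 3 - α ∣ (begin
  ∣ α ∣ ℕ.* ∣ + 3 - α ∣     ≡⟨ ℤP.abs-* α (+ 3 - α) ⟨
  ∣ α * (+ 3 - α) ∣         ≡⟨ cong ∣_∣ (ζ+1 α) ⟩
  ∣ ζ α + + 1 ∣             ≡⟨ cong (λ x → ∣ x + + 1 ∣) ζ≡0 ⟩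
  1                         ∎))
  where
  -- α(3 - α) = ζ + 1, so ζ = 0 makes α a unit
  ζ+1 : ∀ α → α * (+ 3 - α) ≡ (- (α * α) + + 3 * α - + 1) + + 1
  ζ+1 = solve-∀
  -- and neither unit is a root: α = 1 is excluded, ζ(-1) = -5
  unit-case : ∀ α → α ≢ + 1 → ζ α ≡ + 0 → ∣ α ∣ ≡ 1 → ⊥
  unit-case (+ 1)        α≢1 _  _  = α≢1 refl
  unit-case (ℤ.-[1+ 0 ]) _   () _

module Monomials (α : ℤ) where
  β γ : ℤ
  β = α - + 1
  γ = + 2 * α - + 1

  factors : Exps → List ℤ
  factors ⟨ _ ∣ a , b , c , z ⟩ = replicate a α ++ replicate b β ++ replicate c γ ++ replicate z (ζ α)

  powers : ℕ → ℕ → ℕ → ℕ → ℤ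
  powers a b c z = α ^ a * (β ^ b * (γ ^ c * ζ α ^ z))

  -- It is opaque, so that the type checker never
  -- unfolds the huge monomials occurring in W; only the base-case cores,
  -- which are small, are evaluated by unfolding it.
  opaque
    mono : Exps → ℤ
    mono e = signed (Exps.negative e) (prod (factors e))

    mono-𝟙 : mono 𝟙 ≡ + 1
    mono-𝟙 = refl

    mono-powers : ∀ s a b c z → mono ⟨ s ∣ a , b , c , z ⟩ ≡ signed s (powers a b c z)
    mono-powers s a b c z = cong (signed s) (begin
      prod (A ++ B ++ C ++ Z)              ≡⟨ prod-++ A (B ++ C ++ Z) ⟩
      prod A * prod (B ++ C ++ Z)          ≡⟨ cong (prod A *_) (prod-++ B (C ++ Z)) ⟩
      prod A * (prod B * prod (C ++ Z))    ≡⟨ cong (λ x → prod A * (prod B * x)) (prod-++ C Z) ⟩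
      prod A * (prod B * (prod C * prod Z))
        ≡⟨ cong₂ _*_ (prod-replicate a α) (cong₂ _*_ (prod-replicate b β)
             (cong₂ _*_ (prod-replicate c γ) (prod-replicate z (ζ α)))) ⟩
      powers a b c z ∎)
      where
      A B C Z : List ℤ
      A = replicate a α
      B = replicate b β
      C = replicate c γ
      Z = replicate z (ζ α)

  ⟦_⟧ : Term → ℤ
  ⟦ just e ⟧  = mono e
  ⟦ nothing ⟧ = + 0

  powers-+ : ∀ a b c z a′ b′ c′ z′ →
    powers (a ℕ.+ a′) (b ℕ.+ b′) (c ℕ.+ c′) (z ℕ.+ z′) ≡ powers a b c z * powers a′ b′ c′ z′
  powers-+ a b c z a′ b′ c′ z′
    rewrite ℤP.^-distribˡ-+-* α a a′ | ℤP.^-distribˡ-+-* β b b′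
          | ℤP.^-distribˡ-+-* γ c c′ | ℤP.^-distribˡ-+-* (ζ α) z z′ =
    interchange (α ^ a) (α ^ a′) (β ^ b) (β ^ b′) (γ ^ c) (γ ^ c′) (ζ α ^ z) (ζ α ^ z′)
    where
    interchange : ∀ A A′ B B′ C C′ Z Z′ →
      A * A′ * (B * B′ * (C * C′ * (Z * Z′))) ≡ A * (B * (C * Z)) * (A′ * (B′ * (C′ * Z′)))
    interchange = solve-∀

  mono-⊕ : ∀ e e′ → mono (e ⊕ e′) ≡ mono e * mono e′
  mono-⊕ ⟨ s ∣ a , b , c , z ⟩ ⟨ s′ ∣ a′ , b′ , c′ , z′ ⟩ = begin
    mono ⟨ s xor s′ ∣ a ℕ.+ a′ , b ℕ.+ b′ , c ℕ.+ c′ , z ℕ.+ z′ ⟩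
      ≡⟨ mono-powers (s xor s′) (a ℕ.+ a′) (b ℕ.+ b′) (c ℕ.+ c′) (z ℕ.+ z′) ⟩
    signed (s xor s′) (powers (a ℕ.+ a′) (b ℕ.+ b′) (c ℕ.+ c′) (z ℕ.+ z′))
      ≡⟨ cong (signed (s xor s′)) (powers-+ a b c z a′ b′ c′ z′) ⟩
    signed (s xor s′) (powers a b c z * powers a′ b′ c′ z′)
      ≡⟨ signed-* s s′ _ _ ⟨
    signed s (powers a b c z) * signed s′ (powers a′ b′ c′ z′)
      ≡⟨ cong₂ _*_ (mono-powers s a b c z) (mono-powers s′ a′ b′ c′ z′) ⟨
    mono ⟨ s ∣ a , b , c , z ⟩ * mono ⟨ s′ ∣ a′ , b′ , c′ , z′ ⟩ ∎

  mono-· : ∀ n e → mono (n · e) ≡ mono e ^ n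
  mono-· zero    e = mono-𝟙
  mono-· (suc n) e = trans (mono-⊕ e (n · e)) (cong (mono e *_) (mono-· n e))

  mono≢0 : α ≢ + 0 → α ≢ + 1 → ∀ e → mono e ≢ + 0
  mono≢0 α≢0 α≢1 ⟨ s ∣ a , b , c , z ⟩ mono≡0 =
    powers≢0 (signed≡0 s (trans (sym (mono-powers s a b c z)) mono≡0))
    where
    powers≢0 : powers a b c z ≢ + 0
    powers≢0 = nonzero-* (pow≢0 a α≢0) (nonzero-* (pow≢0 b (λ β≡0 → α≢1 (ℤP.i-j≡0⇒i≡j α (+ 1) β≡0)))
                 (nonzero-* (pow≢0 c (2α-1≢0 α)) (pow≢0 z (ζ≢0 α α≢1))))
    signed≡0 : ∀ s {x} → signed s x ≡ + 0 → x ≡ + 0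
    signed≡0 false x≡0  = x≡0
    signed≡0 true  -x≡0 = trans (sym (ℤP.neg-involutive _)) (cong -_ -x≡0)

  ⟦⊗⟧ : ∀ s t → ⟦ s ⊗ t ⟧ ≡ ⟦ s ⟧ * ⟦ t ⟧
  ⟦⊗⟧ (just e) (just e′) = mono-⊕ e e′
  ⟦⊗⟧ (just e) nothing   = sym (ℤP.*-zeroʳ (mono e))
  ⟦⊗⟧ nothing  t         = sym (ℤP.*-zeroˡ ⟦ t ⟧)

  ⟦power⟧ : ∀ n t → ⟦ power n t ⟧ ≡ ⟦ t ⟧ ^ n
  ⟦power⟧ zero    t = mono-𝟙
  ⟦power⟧ (suc n) t = trans (⟦⊗⟧ t (power n t)) (cong (⟦ t ⟧ *_) (⟦power⟧ n t))

  factor : ∀ g t → g ∣ᵗ t → ⟦ t ⟧ ≡ ⟦ g ⟧ * ⟦ t ⊘ g ⟧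
  factor g        nothing  _   = sym (ℤP.*-zeroʳ ⟦ g ⟧)
  factor (just g) (just e) g≼e = trans (cong mono (sym (split g e g≼e))) (mono-⊕ g (e ÷ g))

  Core : Term → Term → Term → Set
  Core t₀ t₁ t₂ = ⟦ t₀ ⊘ g ⟧ ≡ ⟦ t₁ ⊘ g ⟧ - ⟦ t₂ ⊘ g ⟧
    where g = gcdᵗ t₀ (gcdᵗ t₁ t₂)

  core⇒identity : ∀ t₀ t₁ t₂ → Core t₀ t₁ t₂ → ⟦ t₀ ⟧ ≡ ⟦ t₁ ⟧ - ⟦ t₂ ⟧
  core⇒identity t₀ t₁ t₂ core = begin
    ⟦ t₀ ⟧                                     ≡⟨ factor g t₀ g∣t₀ ⟩
    ⟦ g ⟧ * ⟦ t₀ ⊘ g ⟧                         ≡⟨ cong (⟦ g ⟧ *_) core ⟩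
    ⟦ g ⟧ * (⟦ t₁ ⊘ g ⟧ - ⟦ t₂ ⊘ g ⟧)           ≡⟨ distrib-sub ⟦ g ⟧ _ _ ⟩
    ⟦ g ⟧ * ⟦ t₁ ⊘ g ⟧ - ⟦ g ⟧ * ⟦ t₂ ⊘ g ⟧     ≡⟨ cong₂ _-_ (factor g t₁ g∣t₁) (factor g t₂ g∣t₂) ⟨
    ⟦ t₁ ⟧ - ⟦ t₂ ⟧                            ∎
    where
    g : Term
    g = gcdᵗ t₀ (gcdᵗ t₁ t₂)
    g∣t₀ : g ∣ᵗ t₀
    g∣t₀ = gcd-∣ˡ t₀ (gcdᵗ t₁ t₂)
    g∣t₁ : g ∣ᵗ t₁
    g∣t₁ = ∣ᵗ-trans g (gcdᵗ t₁ t₂) t₁ (gcd-∣ʳ t₀ _) (gcd-∣ˡ t₁ t₂)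
    g∣t₂ : g ∣ᵗ t₂
    g∣t₂ = ∣ᵗ-trans g (gcdᵗ t₁ t₂) t₂ (gcd-∣ʳ t₀ _) (gcd-∣ʳ t₁ t₂)

-- The explicit solution.  With P = α²¹(α-1)⁹(2α-1)⁸ζ²⁵ the shift law is
-- W (10 + n) = P⁵ (-P)ⁿ W n; the first ten terms are listed.
cᵉ uᵉ : Exps
cᵉ = ⟨ false ∣ 105 , 45 , 40 , 125 ⟩
uᵉ = ⟨ true ∣ 21 , 9 , 8 , 25 ⟩

E : ℕ → Term
E 0 = nothing
E 1 = just ⟨ false ∣ 0 , 0 , 0 , 0 ⟩
E 2 = just ⟨ true ∣ 3 , 1 , 1 , 4 ⟩
E 3 = just ⟨ true ∣ 9 , 3 , 3 , 10 ⟩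
E 4 = just ⟨ false ∣ 16 , 6 , 6 , 19 ⟩
E 5 = just ⟨ false ∣ 25 , 10 , 10 , 30 ⟩
E 6 = just ⟨ true ∣ 37 , 15 , 14 , 44 ⟩
E 7 = just ⟨ true ∣ 51 , 21 , 19 , 60 ⟩
E 8 = just ⟨ false ∣ 66 , 28 , 25 , 79 ⟩
E 9 = just ⟨ false ∣ 84 , 36 , 32 , 100 ⟩
E (suc (suc (suc (suc (suc (suc (suc (suc (suc (suc n)))))))))) = just (cᵉ ⊕ (n · uᵉ)) ⊗ E n

W : ℤ → ℕ → ℤ
W α n = Monomials.⟦_⟧ α (E n)

-- The identities in α behind the base cases (ζ written out as z):
-- δ = α² - ζ,  (α-1)² = α - ζ,  (α-1)³ = (2α-1) - αζ,  (α-1)² = α² - (2α-1).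
δ-split : ∀ α → let z = - (α * α) + + 3 * α - + 1 in (α - + 1) * (+ 2 * α - + 1) ≡ α * α - z
δ-split = solve-∀

ζ-def : ∀ α → let z = - (α * α) + + 3 * α - + 1 in (α - + 1) * (α - + 1) ≡ α - z
ζ-def = solve-∀

β-cube : ∀ α → let z = - (α * α) + + 3 * α - + 1 in
         (α - + 1) * ((α - + 1) * (α - + 1)) ≡ (+ 2 * α - + 1) - α * z
β-cube = solve-∀

β-square : ∀ α → (α - + 1) * (α - + 1) ≡ α * α - (+ 2 * α - + 1)
β-square = solve-∀

mirror : ∀ {x} p q → x ≡ p - q → x ≡ - q - - p
mirror p q x≡p-q = trans x≡p-q (swap p q)
  where
  swap : ∀ p q → p - q ≡ - q - - p
  swap = solve-∀

module Explicit (α : ℤ) where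
  open Monomials α

  c u : ℤ
  c = mono cᵉ
  u = mono uᵉ

  shift : ∀ n → W α (10 ℕ.+ n) ≡ c * u ^ n * W α n
  shift n = begin
    ⟦ just (cᵉ ⊕ (n · uᵉ)) ⊗ E n ⟧   ≡⟨ ⟦⊗⟧ (just (cᵉ ⊕ (n · uᵉ))) (E n) ⟩
    mono (cᵉ ⊕ (n · uᵉ)) * W α n      ≡⟨ cong (_* W α n) (mono-⊕ cᵉ (n · uᵉ)) ⟩
    c * mono (n · uᵉ) * W α n         ≡⟨ cong (λ x → c * x * W α n) (mono-· n uᵉ) ⟩
    c * u ^ n * W α n                 ∎

  c²≡u¹⁰ : c * c ≡ u ^ 10
  c²≡u¹⁰ = trans (sym (mono-⊕ cᵉ cᵉ)) (trans (cong mono same-exponents) (mono-· 10 uᵉ))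
    where
    same-exponents : cᵉ ⊕ cᵉ ≡ 10 · uᵉ
    same-exponents = refl

  open QuasiPeriodic 10 c u c²≡u¹⁰ (W α) shift public

  product-term : ∀ k i j → ⟦ E i ⊗ power k (E j) ⟧ ≡ W α i * W α j ^ k
  product-term k i j = trans (⟦⊗⟧ (E i) (power k (E j))) (cong (W α i *_) (⟦power⟧ k (E j)))

  odd-check : ∀ m → Core (E (2 ℕ.* m ℕ.+ 1)) (E (m ℕ.+ 2) ⊗ power 3 (E m)) (E (m ℕ.∸ 1) ⊗ power 3 (E (m ℕ.+ 1))) →
              OddLaw (W α) m
  odd-check m core = trans (core⇒identity t₀ t₁ t₂ core)
    (cong₂ _-_ (product-term 3 (m ℕ.+ 2) m) (product-term 3 (m ℕ.∸ 1) (m ℕ.+ 1)))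
    where
    t₀ t₁ t₂ : Term
    t₀ = E (2 ℕ.* m ℕ.+ 1)
    t₁ = E (m ℕ.+ 2) ⊗ power 3 (E m)
    t₂ = E (m ℕ.∸ 1) ⊗ power 3 (E (m ℕ.+ 1))

  even-check : ∀ m → Core (E (2 ℕ.* m) ⊗ E 2) (E m ⊗ (E (m ℕ.+ 2) ⊗ power 2 (E (m ℕ.∸ 1))))
                          (E m ⊗ (E (m ℕ.∸ 2) ⊗ power 2 (E (m ℕ.+ 1)))) →
               EvenLaw (W α) m
  even-check m core = begin
    W α (2 ℕ.* m) * W α 2    ≡⟨ ⟦⊗⟧ (E (2 ℕ.* m)) (E 2) ⟨
    ⟦ t₀ ⟧                   ≡⟨ core⇒identity t₀ t₁ t₂ core ⟩
    ⟦ t₁ ⟧ - ⟦ t₂ ⟧          ≡⟨ cong₂ _-_ (distributed (m ℕ.+ 2) (m ℕ.∸ 1)) (distributed (m ℕ.∸ 2) (m ℕ.+ 1)) ⟩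
    W α m * (W α (m ℕ.+ 2) * W α (m ℕ.∸ 1) ^ 2) - W α m * (W α (m ℕ.∸ 2) * W α (m ℕ.+ 1) ^ 2)
      ≡⟨ distrib-sub (W α m) _ _ ⟨
    W α m * (W α (m ℕ.+ 2) * W α (m ℕ.∸ 1) ^ 2 - W α (m ℕ.∸ 2) * W α (m ℕ.+ 1) ^ 2) ∎
    where
    t₀ t₁ t₂ : Term
    t₀ = E (2 ℕ.* m) ⊗ E 2
    t₁ = E m ⊗ (E (m ℕ.+ 2) ⊗ power 2 (E (m ℕ.∸ 1)))
    t₂ = E m ⊗ (E (m ℕ.∸ 2) ⊗ power 2 (E (m ℕ.+ 1)))
    distributed : ∀ i j → ⟦ E m ⊗ (E i ⊗ power 2 (E j)) ⟧ ≡ W α m * (W α i * W α j ^ 2)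
    distributed i j = trans (⟦⊗⟧ (E m) (E i ⊗ power 2 (E j))) (cong (W α m *_) (product-term 2 i j))

  -- W satisfies both recurrences: ten base instances each, then the shift.
  -- The cores are small monomials, so here mono may be unfolded.
  opaque
    unfolding mono
    odd-law : ∀ m → 2 ℕ.≤ m → OddLaw (W α) m
    odd-law 0  ()
    odd-law 1  (s≤s ())
    odd-law 2  _ = odd-check 2 (mirror (α * α) (ζ α) (δ-split α))
    odd-law 3  _ = odd-check 3 (ζ-def α)
    odd-law 4  _ = odd-check 4 (mirror (+ 2 * α - + 1) (α * ζ α) (β-cube α))
    odd-law 5  _ = odd-check 5 (β-cube α)
    odd-law 6  _ = odd-check 6 (mirror α (ζ α) (ζ-def α))
    odd-law 7  _ = odd-check 7 (δ-split α)
    odd-law 8  _ = odd-check 8 refl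
    odd-law 9  _ = odd-check 9 refl
    odd-law 10 _ = odd-check 10 refl
    odd-law 11 _ = odd-check 11 refl
    odd-law (suc (suc (suc (suc (suc (suc (suc (suc (suc (suc (suc (suc m))))))))))))  _ =
      odd-transfer (suc m) (odd-law (suc (suc m)) (s≤s (s≤s z≤n)))

    even-law : ∀ m → 3 ℕ.≤ m → EvenLaw (W α) m
    even-law 0  ()
    even-law 1  (s≤s ())
    even-law 2  (s≤s (s≤s ()))
    even-law 3  _ = even-check 3 (mirror α (+ 1) refl)
    even-law 4  _ = even-check 4 (β-square α)
    even-law 5  _ = even-check 5 refl
    even-law 6  _ = even-check 6 (mirror (α * α) (+ 2 * α - + 1) (β-square α))
    even-law 7  _ = even-check 7 refl
    even-law 8  _ = even-check 8 refl
    even-law 9  _ = even-check 9 refl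
    even-law 10 _ = even-check 10 refl
    even-law 11 _ = even-check 11 refl
    even-law 12 _ = even-check 12 refl
    even-law (suc (suc (suc (suc (suc (suc (suc (suc (suc (suc (suc (suc (suc m)))))))))))))  _ =
      even-transfer (suc m) (even-law (suc (suc (suc m))) (s≤s (s≤s (s≤s z≤n))))

data Large : ℕ → Set where
  odd  : ∀ m → 2 ℕ.≤ m → Large (2 ℕ.* m ℕ.+ 1)
  even : ∀ m → 3 ℕ.≤ m → Large (2 ℕ.* m)

Large-suc : ∀ {n} → Large n → Large (suc n)
Large-suc (odd m 2≤m)  = subst Large (odd-succ m) (even (suc m) (s≤s 2≤m))
  where
  odd-succ : ∀ m → 2 ℕ.* suc m ≡ suc (2 ℕ.* m ℕ.+ 1)
  odd-succ = ℕRing.solve-∀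
Large-suc (even m 3≤m) = subst Large (even-succ m) (odd m (ℕP.≤-trans (ℕP.n≤1+n 2) 3≤m))
  where
  even-succ : ∀ m → 2 ℕ.* m ℕ.+ 1 ≡ suc (2 ℕ.* m)
  even-succ = ℕRing.solve-∀

large : ∀ k → Large (5 ℕ.+ k)
large zero    = odd 2 ℕP.≤-refl
large (suc k) = Large-suc (large k)

odd-bound : ∀ m → 2 ℕ.≤ m → m ℕ.+ 2 ℕ.< 2 ℕ.* m ℕ.+ 1
odd-bound m 2≤m = subst (m ℕ.+ 2 ℕ.<_) (sym (double+1 m)) (s≤s (ℕP.+-monoʳ-≤ m 2≤m))
  where
  double+1 : ∀ m → 2 ℕ.* m ℕ.+ 1 ≡ suc (m ℕ.+ m)
  double+1 = ℕRing.solve-∀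

even-bound : ∀ m → 3 ℕ.≤ m → m ℕ.+ 2 ℕ.< 2 ℕ.* m
even-bound m 3≤m = subst (m ℕ.+ 2 ℕ.<_) (sym (double m)) (ℕP.+-monoʳ-< m 3≤m)
  where
  double : ∀ m → 2 ℕ.* m ≡ m ℕ.+ m
  double = ℕRing.solve-∀

∸-below : ∀ m k → m ℕ.∸ k ℕ.≤ m ℕ.+ 2
∸-below m k = ℕP.≤-trans (ℕP.m∸n≤m m k) (ℕP.m≤m+n m 2)

^-distrib-* : ∀ (x y : ℤ) n → (x * y) ^ n ≡ x ^ n * y ^ n
^-distrib-* x y zero    = refl
^-distrib-* x y (suc n) = trans (cong (x * y *_) (^-distrib-* x y n)) (interchange x y (x ^ n) (y ^ n))
  where
  interchange : ∀ x y p q → x * y * (p * q) ≡ x * p * (y * q)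
  interchange = solve-∀

initial : ∀ α s a k z → signed s (α ^ a * δ α ^ k * ζ α ^ z) ≡ Monomials.mono α ⟨ s ∣ a , k , k , z ⟩
initial α s a k z = begin
  signed s (α ^ a * δ α ^ k * ζ α ^ z)        ≡⟨ cong (λ x → signed s (α ^ a * x * ζ α ^ z)) (^-distrib-* β γ k) ⟩
  signed s (α ^ a * (β ^ k * γ ^ k) * ζ α ^ z) ≡⟨ cong (signed s) (reassoc (α ^ a) (β ^ k) (γ ^ k) (ζ α ^ z)) ⟩
  signed s (powers a k k z)                    ≡⟨ mono-powers s a k k z ⟨
  mono ⟨ s ∣ a , k , k , z ⟩                   ∎
  where
  open Monomials α
  reassoc : ∀ A B C Z → A * (B * C) * Z ≡ A * (B * (C * Z))
  reassoc = solve-∀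

-- Any solution of the defining equations coincides with W: by strong
-- induction, using the recurrences for h and W and cancelling h₂ = W₂ ≠ 0.
agreement : ∀ α → α ≢ + 0 → α ≢ + 1 → ∀ h → IsSeq α h → ∀ n → h n ≡ W α n
agreement α α≢0 α≢1 h (h₀ , h₁ , h₂ , h₃ , h₄ , h-odd , h-even) = <-rec (λ n → h n ≡ W α n) step
  where
  open Explicit α
  open Monomials α using (mono-𝟙; mono≢0)

  agree₂ : h 2 ≡ W α 2
  agree₂ = trans h₂ (trans (cong (λ x → - (α ^ 3 * x * ζ α ^ 4)) (sym (ℤP.^-identityʳ (δ α)))) (initial α true 3 1 4))

  agree-large : ∀ {n} → Large n → (∀ {i} → i ℕ.< n → h i ≡ W α i) → h n ≡ W α n
  agree-large (odd m 2≤m) below-n = begin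
    h (2 ℕ.* m ℕ.+ 1)                                             ≡⟨ h-odd m 2≤m ⟩
    h (m ℕ.+ 2) * h m ^ 3 - h (m ℕ.∸ 1) * h (m ℕ.+ 1) ^ 3
      ≡⟨ cong₂ _-_ (cong₂ (λ x y → x * y ^ 3) (agree ℕP.≤-refl) (agree (ℕP.m≤m+n m 2)))
                   (cong₂ (λ x y → x * y ^ 3) (agree (∸-below m 1)) (agree (ℕP.+-monoʳ-≤ m (s≤s z≤n)))) ⟩
    W α (m ℕ.+ 2) * W α m ^ 3 - W α (m ℕ.∸ 1) * W α (m ℕ.+ 1) ^ 3  ≡⟨ odd-law m 2≤m ⟨
    W α (2 ℕ.* m ℕ.+ 1)                                            ∎
    where
    agree : ∀ {i} → i ℕ.≤ m ℕ.+ 2 → h i ≡ W α i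
    agree i≤m+2 = below-n (ℕP.≤-<-trans i≤m+2 (odd-bound m 2≤m))
  agree-large (even m 3≤m) below-n =
    ℤP.*-cancelʳ-≡ (h (2 ℕ.* m)) (W α (2 ℕ.* m)) (W α 2) {{ℤ.≢-nonZero (mono≢0 α≢0 α≢1 _)}} (begin
      h (2 ℕ.* m) * W α 2                 ≡⟨ cong (h (2 ℕ.* m) *_) agree₂ ⟨
      h (2 ℕ.* m) * h 2                   ≡⟨ h-even m 3≤m ⟩
      h m * (h (m ℕ.+ 2) * h (m ℕ.∸ 1) ^ 2 - h (m ℕ.∸ 2) * h (m ℕ.+ 1) ^ 2)
        ≡⟨ cong₂ _*_ (agree (ℕP.m≤m+n m 2))
             (cong₂ _-_ (cong₂ (λ x y → x * y ^ 2) (agree ℕP.≤-refl) (agree (∸-below m 1)))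
                        (cong₂ (λ x y → x * y ^ 2) (agree (∸-below m 2)) (agree (ℕP.+-monoʳ-≤ m (s≤s z≤n))))) ⟩
      W α m * (W α (m ℕ.+ 2) * W α (m ℕ.∸ 1) ^ 2 - W α (m ℕ.∸ 2) * W α (m ℕ.+ 1) ^ 2)
        ≡⟨ even-law m 3≤m ⟨
      W α (2 ℕ.* m) * W α 2               ∎)
    where
    agree : ∀ {i} → i ℕ.≤ m ℕ.+ 2 → h i ≡ W α i
    agree i≤m+2 = below-n (ℕP.≤-<-trans i≤m+2 (even-bound m 3≤m))

  step : ∀ n → (∀ {i} → i ℕ.< n → h i ≡ W α i) → h n ≡ W α n
  step 0 _ = h₀
  step 1 _ = trans h₁ (sym mono-𝟙)
  step 2 _ = agree₂
  step 3 _ = trans h₃ (initial α true 9 3 10)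
  step 4 _ = trans h₄ (initial α false 16 6 19)
  step (suc (suc (suc (suc (suc k))))) below-n = agree-large (large k) below-n

square-factor : ∀ {x y} b → b ≢ + 0 → x ≡ b * b * y → x ∼ y
square-factor b b≢0 x≡b²y = b , b≢0 , inj₁ x≡b²y

signed-∼ : ∀ s x → signed s x ∼ x
signed-∼ false x = + 1 , (λ ()) , inj₁ (sym (ℤP.*-identityˡ x))
signed-∼ true  x = + 1 , (λ ()) , inj₂ (cong -_ (sym (ℤP.*-identityˡ x)))

module Classes (α : ℤ) (α≢0 : α ≢ + 0) (α≢1 : α ≢ + 1) where
  open Explicit α
  open Monomials α

  -- W (20 + n) = (c² uⁿ)² W n, so the class of W n only depends on n mod 20.
  periodic : ∀ q r → W α (r ℕ.+ q ℕ.* 20) ∼ W α r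
  periodic zero    r = square-factor (+ 1) (λ ()) (trans (cong (W α) (ℕP.+-identityʳ r)) (sym (ℤP.*-identityˡ (W α r))))
  periodic (suc q) r = ∼-trans (square-factor S S≢0 (trans (cong (W α) (index q r)) (twice n))) (periodic q r)
    where
    n : ℕ
    n = r ℕ.+ q ℕ.* 20
    S : ℤ
    S = c * c * u ^ n
    S≢0 : S ≢ + 0
    S≢0 = nonzero-* (nonzero-* c≢0 c≢0) (pow≢0 n (mono≢0 α≢0 α≢1 uᵉ))
      where
      c≢0 : c ≢ + 0
      c≢0 = mono≢0 α≢0 α≢1 cᵉ
    index : ∀ q r → r ℕ.+ suc q ℕ.* 20 ≡ 10 ℕ.+ (10 ℕ.+ (r ℕ.+ q ℕ.* 20))
    index = ℕRing.solve-∀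

  class-mod-20 : ∀ n → W α n ∼ W α (n % 20)
  class-mod-20 n = subst (λ k → W α k ∼ W α (n % 20)) (sym (m≡m%n+[m/n]*n n 20)) (periodic (n ℕ./ 20) (n % 20))

  class-of : ∀ r g e → E r ≡ just (g ⊕ (g ⊕ e)) → W α r ∼ mono e
  class-of r g e E≡ = square-factor (mono g) (mono≢0 α≢0 α≢1 g) (begin
    W α r                          ≡⟨ cong ⟦_⟧ E≡ ⟩
    mono (g ⊕ (g ⊕ e))             ≡⟨ mono-⊕ g (g ⊕ e) ⟩
    mono g * mono (g ⊕ e)          ≡⟨ cong (mono g *_) (mono-⊕ g e) ⟩
    mono g * (mono g * mono e)     ≡⟨ ℤP.*-assoc (mono g) (mono g) (mono e) ⟨
    mono g * mono g * mono e       ∎)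

  unit-class : ∀ s → mono ⟨ s ∣ 0 , 0 , 0 , 0 ⟩ ∼ + 1
  unit-class s = subst (_∼ + 1) (sym (mono-powers s 0 0 0 0)) (signed-∼ s (+ 1))

  α-class : ∀ s → mono ⟨ s ∣ 1 , 0 , 0 , 0 ⟩ ∼ α
  α-class s = subst (_∼ α) (sym (trans (mono-powers s 1 0 0 0) (cong (signed s) (only-first α))))
                (signed-∼ s α)
    where
    only-first : ∀ x → x * + 1 * (+ 1 * (+ 1 * + 1)) ≡ x
    only-first = solve-∀

  ζ-class : ∀ s → mono ⟨ s ∣ 0 , 0 , 0 , 1 ⟩ ∼ ζ α
  ζ-class s = subst (_∼ ζ α) (sym (trans (mono-powers s 0 0 0 1) (cong (signed s) (only-last (ζ α)))))
                (signed-∼ s (ζ α))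
    where
    only-last : ∀ x → + 1 * (+ 1 * (+ 1 * (x * + 1))) ≡ x
    only-last = solve-∀

  square-residues : ∀ {r} → r ≡ 1 ⊎ r ≡ 9 ⊎ r ≡ 11 ⊎ r ≡ 19 → W α r ∼ + 1
  square-residues (inj₁ refl) =
    ∼-trans (class-of 1 𝟙 ⟨ false ∣ 0 , 0 , 0 , 0 ⟩ refl) (unit-class false)
  square-residues (inj₂ (inj₁ refl)) =
    ∼-trans (class-of 9 ⟨ false ∣ 42 , 18 , 16 , 50 ⟩ ⟨ false ∣ 0 , 0 , 0 , 0 ⟩ refl) (unit-class false)
  square-residues (inj₂ (inj₂ (inj₁ refl))) =
    ∼-trans (class-of 11 ⟨ false ∣ 63 , 27 , 24 , 75 ⟩ ⟨ true ∣ 0 , 0 , 0 , 0 ⟩ refl) (unit-class true)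
  square-residues (inj₂ (inj₂ (inj₂ refl))) =
    ∼-trans (class-of 19 ⟨ false ∣ 189 , 81 , 72 , 225 ⟩ ⟨ true ∣ 0 , 0 , 0 , 0 ⟩ refl) (unit-class true)

  ζ-residues : ∀ {r} → r ≡ 4 ⊎ r ≡ 16 → W α r ∼ ζ α
  ζ-residues (inj₁ refl) =
    ∼-trans (class-of 4 ⟨ false ∣ 8 , 3 , 3 , 9 ⟩ ⟨ false ∣ 0 , 0 , 0 , 1 ⟩ refl) (ζ-class false)
  ζ-residues (inj₂ refl) =
    ∼-trans (class-of 16 ⟨ false ∣ 134 , 57 , 51 , 159 ⟩ ⟨ true ∣ 0 , 0 , 0 , 1 ⟩ refl) (ζ-class true)

  α-residues : ∀ {r} → r ≡ 5 ⊎ r ≡ 15 → W α r ∼ α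
  α-residues (inj₁ refl) =
    ∼-trans (class-of 5 ⟨ false ∣ 12 , 5 , 5 , 15 ⟩ ⟨ false ∣ 1 , 0 , 0 , 0 ⟩ refl) (α-class false)
  α-residues (inj₂ refl) =
    ∼-trans (class-of 15 ⟨ false ∣ 117 , 50 , 45 , 140 ⟩ ⟨ true ∣ 1 , 0 , 0 , 0 ⟩ refl) (α-class true)

theorem5p19 : (α : ℤ) → α ≢ + 0 → α ≢ + 1 → (h : ℕ → ℤ) → IsSeq α h →
    ((n : ℕ) → (n % 20 ≡ 1 ⊎ n % 20 ≡ 9 ⊎ n % 20 ≡ 11 ⊎ n % 20 ≡ 19) → IsSquare (h n))
    × ((n : ℕ) → (n % 20 ≡ 4 ⊎ n % 20 ≡ 16) → (IsSquare (h n) ⇔ IsSquare (ζ α)))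
    × ((n : ℕ) → (n % 20 ≡ 5 ⊎ n % 20 ≡ 15) → (IsSquare (h n) ⇔ IsSquare α))
theorem5p19 α α≢0 α≢1 h seq =
    (λ n r → ∼1⇒square (∼-trans (h-class n) (square-residues r)))
  , (λ n r → ∼-square-iff (∼-trans (h-class n) (ζ-residues r)))
  , (λ n r → ∼-square-iff (∼-trans (h-class n) (α-residues r)))
  where
  open Classes α α≢0 α≢1
  h-class : ∀ n → h n ∼ W α (n % 20)
  h-class n = subst (_∼ W α (n % 20)) (sym (agreement α α≢0 α≢1 h seq n)) (class-mod-20 n)
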